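{- $\mathsf{LKur}\subseteq\mathsf{GKur}$.
   Context: $\mathcal{L}_{\forall\exists}$ is the intuitionistic propositional language with modalities $\forall,\exists$; $\mathsf{MIPC}$ is the smallest set of $\mathcal{L}_{\forall\exists}$-formulas containing all intuitionistic propositional theorems, $\forall(p\wedge q)\leftrightarrow(\forall p\wedge\forall q)$, $\forall p\to p$, $\forall p\to\forall\forall p$, $\exists(p\vee q)\leftrightarrow(\exists p\vee\exists q)$, $p\to\exists p$, $\exists\exists p\to\exists p$, $(\exists p\wedge\exists q)\to\exists(\exists p\wedge q)$, $\exists\forall p\to\forall p$, $\exists p\to\forall\exists p$, closed under modus ponens, substitution and $\varphi/\forall\varphi$; $\mathsf{Kur}$ is the smallest such set also containing $\forall\neg\neg p\to\neg\neg\forall p$. $\mathsf{MS4}$ is the smallest set of formulas in the classical language with modalities $\Box,\forall$ ($\Diamond=\neg\Box\neg$, $\exists=\neg\forall\neg$) containing classical tautologies, $\mathsf{S4}$ axioms for $\Box$, $\mathsf{S5}$ axioms for $\forall$, and $\Box\forall p\to\forall\Box p$, closed under modus ponens, substitution, and necessitation for $\Box$ and $\forall$; $\mathsf{MS4}+\Gamma$ is the smallest such set containing $\Gamma$. $\mathsf{LKur}=\mathsf{MS4}+(\Box\forall\Diamond\Box p\to\Diamond\forall p)$. Gödel translation: $\bot^t=\bot$, $p^t=\Box p$, $(\varphi\wedge\psi)^t=\varphi^t\wedge\psi^t$, $(\varphi\vee\psi)^t=\varphi^t\vee\psi^t$, $(\varphi\to\psi)^t=\Box(\neg\varphi^t\vee\psi^t)$,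 $(\forall\varphi)^t=\Box\forall\varphi^t$, $(\exists\varphi)^t=\exists\varphi^t$. $\mathsf{GKur}=\mathsf{MS4}+\{\varphi^t:\mathsf{Kur}\vdash\varphi\}$. -}

module Defs where

open import Data.Nat using (ℕ)
open import Data.Bool using (Bool; true; false; _∧_; _∨_; not)
open import Relation.Binary.PropositionalEquality using (_≡_)

data IFm : Set where
  ivar : ℕ → IFm
  i⊥   : IFm
  _i∧_ _i∨_ _i⇒_ : IFm → IFm → IFm
  i∀ i∃ : IFm → IFm

infixr 6 _i∧_
infixr 5 _i∨_
infixr 4 _i⇒_

_i⇔_ : IFm → IFm → IFm
a i⇔ b = (a i⇒ b) i∧ (b i⇒ a)

i¬ : IFm → IFm
i¬ a = a i⇒ i⊥

isubst : (ℕ → IFm) → IFm → IFm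
isubst σ (ivar n) = σ n
isubst σ i⊥ = i⊥
isubst σ (a i∧ b) = isubst σ a i∧ isubst σ b
isubst σ (a i∨ b) = isubst σ a i∨ isubst σ b
isubst σ (a i⇒ b) = isubst σ a i⇒ isubst σ b
isubst σ (i∀ a) = i∀ (isubst σ a)
isubst σ (i∃ a) = i∃ (isubst σ a)

ip iq ir : IFm
ip = ivar 0
iq = ivar 1
ir = ivar 2

-- Hilbert axioms of intuitionistic propositional logic (in letters p,q,r);
-- together with modus ponens and substitution they generate exactly the
-- (substitution instances of) intuitionistic propositional theorems.
data IPCAx : IFm → Set where
  ax1 : IPCAx (ip i⇒ (iq i⇒ ip))
  ax2 : IPCAx ((ip i⇒ (iq i⇒ ir)) i⇒ ((ip i⇒ iq) i⇒ (ip i⇒ ir)))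
  ax3 : IPCAx ((ip i∧ iq) i⇒ ip)
  ax4 : IPCAx ((ip i∧ iq) i⇒ iq)
  ax5 : IPCAx (ip i⇒ (iq i⇒ (ip i∧ iq)))
  ax6 : IPCAx (ip i⇒ (ip i∨ iq))
  ax7 : IPCAx (iq i⇒ (ip i∨ iq))
  ax8 : IPCAx ((ip i⇒ ir) i⇒ ((iq i⇒ ir) i⇒ ((ip i∨ iq) i⇒ ir)))
  ax9 : IPCAx (i⊥ i⇒ ip)

data MIPCAx : IFm → Set where
  ∀∧   : MIPCAx (i∀ (ip i∧ iq) i⇔ (i∀ ip i∧ i∀ iq))
  ∀T   : MIPCAx (i∀ ip i⇒ ip)
  ∀4   : MIPCAx (i∀ ip i⇒ i∀ (i∀ ip))
  ∃∨   : MIPCAx (i∃ (ip i∨ iq) i⇔ (i∃ ip i∨ i∃ iq))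
  ∃T   : MIPCAx (ip i⇒ i∃ ip)
  ∃4   : MIPCAx (i∃ (i∃ ip) i⇒ i∃ ip)
  ∃∃   : MIPCAx ((i∃ ip i∧ i∃ iq) i⇒ i∃ (i∃ ip i∧ iq))
  ∃∀   : MIPCAx (i∃ (i∀ ip) i⇒ i∀ ip)
  ∃∀∃  : MIPCAx (i∃ ip i⇒ i∀ (i∃ ip))

KurAx : IFm
KurAx = i∀ (i¬ (i¬ ip)) i⇒ i¬ (i¬ (i∀ ip))

data Kur⊢ : IFm → Set where
  ipc   : ∀ {a} → IPCAx a → Kur⊢ a
  mipc  : ∀ {a} → MIPCAx a → Kur⊢ a
  kur   : Kur⊢ KurAx
  mp    : ∀ {a b} → Kur⊢ (a i⇒ b) → Kur⊢ a → Kur⊢ b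
  sub   : ∀ {a} (σ : ℕ → IFm) → Kur⊢ a → Kur⊢ (isubst σ a)
  nec∀  : ∀ {a} → Kur⊢ a → Kur⊢ (i∀ a)

data Fm : Set where
  var : ℕ → Fm
  ⊥'  : Fm
  _∧'_ _∨'_ _⇒_ : Fm → Fm → Fm
  □ ∀' : Fm → Fm

infixr 6 _∧'_
infixr 5 _∨'_
infixr 4 _⇒_

¬' : Fm → Fm
¬' a = a ⇒ ⊥'

◇ : Fm → Fm
◇ a = ¬' (□ (¬' a))

∃' : Fm → Fm
∃' a = ¬' (∀' (¬' a))

subst' : (ℕ → Fm) → Fm → Fm
subst' σ (var n) = σ n
subst' σ ⊥' = ⊥'
subst' σ (a ∧' b) = subst' σ a ∧' subst' σ b
subst' σ (a ∨' b) = subst' σ a ∨' subst' σ b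
subst' σ (a ⇒ b) = subst' σ a ⇒ subst' σ b
subst' σ (□ a) = □ (subst' σ a)
subst' σ (∀' a) = ∀' (subst' σ a)

-- Classical (truth-functional) evaluation: letters and modalized
-- formulas are atoms whose truth values are given by v.
eval : (Fm → Bool) → Fm → Bool
eval v (var n) = v (var n)
eval v ⊥' = false
eval v (a ∧' b) = eval v a ∧ eval v b
eval v (a ∨' b) = eval v a ∨ eval v b
eval v (a ⇒ b) = not (eval v a) ∨ eval v b
eval v (□ a) = v (□ a)
eval v (∀' a) = v (∀' a)

Tautology : Fm → Set
Tautology a = (v : Fm → Bool) → eval v a ≡ true

p q : Fm
p = var 0
q = var 1

data MS4Ax : Fm → Set where
  □K  : MS4Ax (□ (p ⇒ q) ⇒ (□ p ⇒ □ q))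
  □T  : MS4Ax (□ p ⇒ p)
  □4  : MS4Ax (□ p ⇒ □ (□ p))
  ∀K  : MS4Ax (∀' (p ⇒ q) ⇒ (∀' p ⇒ ∀' q))
  ∀T  : MS4Ax (∀' p ⇒ p)
  ∀5  : MS4Ax (∃' p ⇒ ∀' (∃' p))
  □∀  : MS4Ax (□ (∀' p) ⇒ ∀' (□ p))

data MS4+_⊢_ (Γ : Fm → Set) : Fm → Set where
  taut : ∀ {a} → Tautology a → MS4+ Γ ⊢ a
  ms4  : ∀ {a} → MS4Ax a → MS4+ Γ ⊢ a
  extra : ∀ {a} → Γ a → MS4+ Γ ⊢ a
  mp   : ∀ {a b} → MS4+ Γ ⊢ (a ⇒ b) → MS4+ Γ ⊢ a → MS4+ Γ ⊢ b
  sub  : ∀ {a} (σ : ℕ → Fm) → MS4+ Γ ⊢ a → MS4+ Γ ⊢ subst' σ a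
  nec□ : ∀ {a} → MS4+ Γ ⊢ a → MS4+ Γ ⊢ □ a
  nec∀ : ∀ {a} → MS4+ Γ ⊢ a → MS4+ Γ ⊢ ∀' a

_ᵗ : IFm → Fm
ivar n ᵗ = □ (var n)
i⊥ ᵗ = ⊥'
(a i∧ b) ᵗ = (a ᵗ) ∧' (b ᵗ)
(a i∨ b) ᵗ = (a ᵗ) ∨' (b ᵗ)
(a i⇒ b) ᵗ = □ (¬' (a ᵗ) ∨' (b ᵗ))
i∀ a ᵗ = □ (∀' (a ᵗ))
i∃ a ᵗ = ∃' (a ᵗ)

data LKurAx : Fm → Set where
  lkur : LKurAx (□ (∀' (◇ (□ p))) ⇒ ◇ (∀' p))

data GKurAx : Fm → Set where
  gkur : ∀ {a} → Kur⊢ a → GKurAx (a ᵗ)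

LKur⊢ GKur⊢ : Fm → Set
LKur⊢ = MS4+ LKurAx ⊢_
GKur⊢ = MS4+ GKurAx ⊢_

module Submission where

open import Defs
open import Data.Nat using (ℕ; zero; suc)
open import Data.Bool using (true; false)
open import Relation.Binary.PropositionalEquality using (refl)

-- Proof idea: every LKur-derivation is a GKur-derivation once the LKur axiom
-- □∀◇□p → ◇∀p is derived in GKur. Since □◇□p implies the translation of ¬¬p,
-- the premise gives □∀(¬¬p)ᵗ; the translated Kuroda axiom turns this into
-- (¬¬∀p)ᵗ, which classically yields ◇□∀□p and hence ◇∀p.

MS4+-⊆ : ∀ {Γ Δ} → (∀ {a} → Γ a → MS4+ Δ ⊢ a) → ∀ {a} → MS4+ Γ ⊢ a → MS4+ Δ ⊢ a
MS4+-⊆ Γ⊆Δ (taut t)  = taut t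
MS4+-⊆ Γ⊆Δ (ms4 ax)  = ms4 ax
MS4+-⊆ Γ⊆Δ (extra γ) = Γ⊆Δ γ
MS4+-⊆ Γ⊆Δ (mp d e)  = mp (MS4+-⊆ Γ⊆Δ d) (MS4+-⊆ Γ⊆Δ e)
MS4+-⊆ Γ⊆Δ (sub σ d) = sub σ (MS4+-⊆ Γ⊆Δ d)
MS4+-⊆ Γ⊆Δ (nec□ d)  = nec□ (MS4+-⊆ Γ⊆Δ d)
MS4+-⊆ Γ⊆Δ (nec∀ d)  = nec∀ (MS4+-⊆ Γ⊆Δ d)

p,q↦ : Fm → Fm → ℕ → Fm
p,q↦ x y zero          = x
p,q↦ x y (suc zero)    = y
p,q↦ x y (suc (suc n)) = var (suc (suc n))

-- (i¬ φ) ᵗ reduces to ∼ (φ ᵗ).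
∼ : Fm → Fm
∼ x = □ (¬' x ∨' ⊥')

module Tautologies where

  ⇒-trans : ∀ x y z → Tautology ((x ⇒ y) ⇒ ((y ⇒ z) ⇒ (x ⇒ z)))
  ⇒-trans x y z v with eval v x | eval v y | eval v z
  ... | true  | true  | true  = refl
  ... | true  | true  | false = refl
  ... | true  | false | _     = refl
  ... | false | true  | true  = refl
  ... | false | true  | false = refl
  ... | false | false | true  = refl
  ... | false | false | false = refl

  contraposition : ∀ x y → Tautology ((x ⇒ y) ⇒ (¬' y ⇒ ¬' x))
  contraposition x y v with eval v x | eval v y
  ... | true  | true  = refl
  ... | true  | false = refl
  ... | false | true  = refl
  ... | false | false = refl

  ∨⊥-intro : ∀ x → Tautology (x ⇒ x ∨' ⊥')
  ∨⊥-intro x v with eval v x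
  ... | true  = refl
  ... | false = refl

  ∨⊥-elim : ∀ x → Tautology (x ∨' ⊥' ⇒ x)
  ∨⊥-elim x v with eval v x
  ... | true  = refl
  ... | false = refl

  ¬∨⇒⇒ : ∀ x y → Tautology ((¬' x ∨' y) ⇒ (x ⇒ y))
  ¬∨⇒⇒ x y v with eval v x | eval v y
  ... | true  | true  = refl
  ... | true  | false = refl
  ... | false | _     = refl

module Derived {Γ : Fm → Set} where

  infix 2 ⊢_
  ⊢_ : Fm → Set
  ⊢_ = MS4+ Γ ⊢_

  ⊢-trans : ∀ {x y z} → ⊢ x ⇒ y → ⊢ y ⇒ z → ⊢ x ⇒ z
  ⊢-trans {x} {y} {z} d e = mp (mp (taut (Tautologies.⇒-trans x y z)) d) e

  ⊢-contra : ∀ {x y} → ⊢ x ⇒ y → ⊢ ¬' y ⇒ ¬' x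
  ⊢-contra {x} {y} d = mp (taut (Tautologies.contraposition x y)) d

  □-mono : ∀ {x y} → ⊢ x ⇒ y → ⊢ □ x ⇒ □ y
  □-mono {x} {y} d = mp (sub (p,q↦ x y) (ms4 □K)) (nec□ d)

  ∀-mono : ∀ {x y} → ⊢ x ⇒ y → ⊢ ∀' x ⇒ ∀' y
  ∀-mono {x} {y} d = mp (sub (p,q↦ x y) (ms4 ∀K)) (nec∀ d)

  □-T : ∀ x → ⊢ □ x ⇒ x
  □-T x = sub (p,q↦ x x) (ms4 □T)

  □-4 : ∀ x → ⊢ □ x ⇒ □ (□ x)
  □-4 x = sub (p,q↦ x x) (ms4 □4)

  □∀⇒∀□ : ∀ x → ⊢ □ (∀' x) ⇒ ∀' (□ x)
  □∀⇒∀□ x = sub (p,q↦ x x) (ms4 □∀)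

  □◇⇒∼∼ : ∀ x → ⊢ □ (◇ x) ⇒ ∼ (∼ x)
  □◇⇒∼∼ x = □-mono (⊢-trans ◇⇒¬∼ (taut (Tautologies.∨⊥-intro (¬' (∼ x)))))
    where
    ◇⇒¬∼ : ⊢ ◇ x ⇒ ¬' (∼ x)
    ◇⇒¬∼ = ⊢-contra (□-mono (taut (Tautologies.∨⊥-elim (¬' x))))

  ∼∼⇒◇ : ∀ {x y} → ⊢ x ⇒ y → ⊢ ∼ (∼ x) ⇒ ◇ y
  ∼∼⇒◇ {x} {y} x⇒y = ⊢-trans ∼∼⇒¬∼ ¬∼⇒◇
    where
    ∼∼⇒¬∼ : ⊢ ∼ (∼ x) ⇒ ¬' (∼ x)
    ∼∼⇒¬∼ = ⊢-trans (□-T _) (taut (Tautologies.∨⊥-elim (¬' (∼ x))))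
    ¬∼⇒◇ : ⊢ ¬' (∼ x) ⇒ ◇ y
    ¬∼⇒◇ = ⊢-contra (□-mono (⊢-trans (⊢-contra x⇒y) (taut (Tautologies.∨⊥-intro (¬' x)))))

open Derived {GKurAx}

Kurᵗ : GKur⊢ (□ (∀' (∼ (∼ (□ p)))) ⇒ ∼ (∼ (□ (∀' (□ p)))))
Kurᵗ = mp (taut (Tautologies.¬∨⇒⇒ (□ (∀' (∼ (∼ (□ p))))) (∼ (∼ (□ (∀' (□ p)))))))
          (mp (□-T _) (extra (gkur kur)))

LKurAx-in-GKur : GKur⊢ (□ (∀' (◇ (□ p))) ⇒ ◇ (∀' p))
LKurAx-in-GKur =
  ⊢-trans (□-4 _)
  (⊢-trans (□-mono (□∀⇒∀□ _))
  (⊢-trans (□-mono (∀-mono (□◇⇒∼∼ (□ p))))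
  (⊢-trans Kurᵗ
           (∼∼⇒◇ (⊢-trans (□-T _) (∀-mono (□-T p)))))))

lemma4p7 : ∀ (a : Fm) → LKur⊢ a → GKur⊢ a
lemma4p7 a = MS4+-⊆ λ { lkur → LKurAx-in-GKur }
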